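{- Let $A,B,C$ be non-empty sets, $I$ a non-empty index set, $\{V_i\}_{i\in I}\subseteq\mathcal{R}(A)$, $\{W_i\}_{i\in I}\subseteq\mathcal{R}(B)$, $\{X_i\}_{i\in I}\subseteq\mathcal{R}(C)$, $Z\in\mathcal{R}(A,B)$, $Y\in\mathcal{R}(B,C)$. If $R\in\mathcal{R}(A,B)$ is a solution to $WL^{2\text{ - }3}(A,B,I,V_i,W_i,Z)$ and $S\in\mathcal{R}(B,C)$ is a solution to $WL^{2\text{ - }3}(B,C,I,W_i,X_i,Y)$, then $R\circ S$ is a solution to $WL^{2\text{ - }3}(A,C,I,V_i,X_i,Z\circ Y)$.
   Context: $\mathcal{L}=(L,\wedge,\vee,\otimes,\to,0,1)$ is a complete residuated lattice. $\mathcal{R}(A,B)$ is the set of fuzzy relations $A\times B\to L$, $\mathcal{R}(A)=\mathcal{R}(A,A)$, ordered pointwise; $R^{ -1}(b,a)=R(a,b)$; $(R\circ S)(a,c)=\bigvee_b R(a,b)\otimes S(b,c)$. For non-empty sets $P,Q$, families $\{V_i\}_{i\in I}\subseteq\mathcal{R}(P)$, $\{W_i\}_{i\in I}\subseteq\mathcal{R}(Q)$ and $Z\in\mathcal{R}(P,Q)$, the system $WL^{2\text{ - }3}(P,Q,I,V_i,W_i,Z)$ in the unknown $U\in\mathcal{R}(P,Q)$ consists of $U^{ -1}\circ V_i\le W_i\circ U^{ -1}$ and $U\circ W_i\le V_i\circ U$ for all $i\in I$, and $U\le Z$; a solution is an $R\in\mathcal{R}(P,Q)$ satisfying these with $U=R$.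 -}

module Defs where

open import Level using (Level; _⊔_; suc)
open import Data.Product using (∃; _×_; _,_)
open import Relation.Binary.Structures using (IsPartialOrder)
open import Relation.Binary.Core using (Rel)

record CompleteResiduatedLattice (a c ℓ₁ ℓ₂ : Level) : Set (suc (a ⊔ c ⊔ ℓ₁ ⊔ ℓ₂)) where
  infixr 6 _∨_
  infixr 7 _∧_
  infixr 7 _⊗_
  infixr 5 _⇒_
  infix 4 _≈_ _≤_
  field
    Carrier : Set c
    _≈_ : Rel Carrier ℓ₁
    _≤_ : Rel Carrier ℓ₂
    isPartialOrder : IsPartialOrder _≈_ _≤_
    _∧_ _∨_ _⊗_ _⇒_ : Carrier → Carrier → Carrier
    𝟘 𝟙 : Carrier
    ∧-lb₁ : ∀ x y → x ∧ y ≤ x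
    ∧-lb₂ : ∀ x y → x ∧ y ≤ y
    ∧-glb : ∀ x y z → z ≤ x → z ≤ y → z ≤ x ∧ y
    ∨-ub₁ : ∀ x y → x ≤ x ∨ y
    ∨-ub₂ : ∀ x y → y ≤ x ∨ y
    ∨-lub : ∀ x y z → x ≤ z → y ≤ z → x ∨ y ≤ z
    𝟘-min : ∀ x → 𝟘 ≤ x
    𝟙-max : ∀ x → x ≤ 𝟙
    ⋁ : {X : Set a} → (X → Carrier) → Carrier
    ⋁-ub : {X : Set a} (f : X → Carrier) (x : X) → f x ≤ ⋁ f
    ⋁-lub : {X : Set a} (f : X → Carrier) (z : Carrier) → (∀ x → f x ≤ z) → ⋁ f ≤ z
    ⋀ : {X : Set a} → (X → Carrier) → Carrier
    ⋀-lb : {X : Set a} (f : X → Carrier) (x : X) → ⋀ f ≤ f x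
    ⋀-glb : {X : Set a} (f : X → Carrier) (z : Carrier) → (∀ x → z ≤ f x) → z ≤ ⋀ f
    ⊗-assoc : ∀ x y z → (x ⊗ y) ⊗ z ≈ x ⊗ (y ⊗ z)
    ⊗-comm : ∀ x y → x ⊗ y ≈ y ⊗ x
    ⊗-identityʳ : ∀ x → x ⊗ 𝟙 ≈ x
    ⊗-cong : ∀ {x x′ y y′} → x ≈ x′ → y ≈ y′ → x ⊗ y ≈ x′ ⊗ y′
    ⇒-cong : ∀ {x x′ y y′} → x ≈ x′ → y ≈ y′ → (x ⇒ y) ≈ (x′ ⇒ y′)
    residuation₁ : ∀ x y z → x ⊗ y ≤ z → x ≤ y ⇒ z
    residuation₂ : ∀ x y z → x ≤ y ⇒ z → x ⊗ y ≤ z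

module FuzzyRelations {a c ℓ₁ ℓ₂} (𝓛 : CompleteResiduatedLattice a c ℓ₁ ℓ₂) where
  open CompleteResiduatedLattice 𝓛

  FRel : Set a → Set a → Set (a ⊔ c)
  FRel A B = A → B → Carrier

  _⊑_ : {A B : Set a} → FRel A B → FRel A B → Set (a ⊔ ℓ₂)
  R ⊑ S = ∀ x y → R x y ≤ S x y

  _⁻¹ : {A B : Set a} → FRel A B → FRel B A
  (R ⁻¹) b x = R x b

  _∘ᶠ_ : {A B C : Set a} → FRel A B → FRel B C → FRel A C
  (R ∘ᶠ S) x z = ⋁ (λ b → R x b ⊗ S b z)

  SolutionWL23 : (P Q I : Set a) → (I → FRel P P) → (I → FRel Q Q) → FRel P Q → FRel P Q → Set (a ⊔ ℓ₂)
  SolutionWL23 P Q I V W Z R =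
    ((i : I) → ((R ⁻¹) ∘ᶠ V i) ⊑ (W i ∘ᶠ (R ⁻¹)))
    × ((i : I) → (R ∘ᶠ W i) ⊑ (V i ∘ᶠ R))
    × (R ⊑ Z)

-- Read as inequalities in the ordered monoid of fuzzy relations, the two
-- families of conditions of WL^{2-3} both say that a relation "simulates"
-- one family by another: R ∘ W i ⊑ V i ∘ R for R, and the same shape for
-- R⁻¹ with the roles of V and W swapped.  Such simulation inequalities
-- compose: if P ∘ M ⊑ U ∘ P and Q ∘ N ⊑ M ∘ Q then (P ∘ Q) ∘ N ⊑ U ∘ (P ∘ Q),
-- by a four-step calculation using only associativity and monotonicity of
-- composition.  Since (R ∘ S)⁻¹ = S⁻¹ ∘ R⁻¹, both conditions for R ∘ S are
-- instances of this one lemma, and the bound R ∘ S ⊑ Z ∘ Y is monotonicity.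

module Submission where

open import Defs
open import Level using (Level; _⊔_)
open import Data.Product using (_,_)
open import Relation.Binary.Bundles using (Poset)
open import Relation.Binary.Structures using (IsPreorder)
import Relation.Binary.Reasoning.PartialOrder as PosetReasoning
import Relation.Binary.Reasoning.Base.Double as PreorderReasoning
open import Relation.Binary.Reasoning.Syntax using (module ⊑-syntax; module ≃-syntax)

module ResiduatedLatticeFacts {a c ℓ₁ ℓ₂} (𝓛 : CompleteResiduatedLattice a c ℓ₁ ℓ₂) where
  open CompleteResiduatedLattice 𝓛

  poset : Poset c ℓ₁ ℓ₂
  poset = record { isPartialOrder = isPartialOrder }

  open Poset poset public using (reflexive; antisym; trans)
    renaming (refl to ≤-refl; module Eq to ≈)
  open PosetReasoning poset

  -- ⊗ is monotone in its left argument: x ⊗ y ≤ x′ ⊗ y follows from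
  -- x ≤ x′ ≤ y ⇒ (x′ ⊗ y) by residuation.
  ⊗-monoˡ : ∀ {x x′} y → x ≤ x′ → x ⊗ y ≤ x′ ⊗ y
  ⊗-monoˡ {x} {x′} y x≤x′ =
    residuation₂ x y (x′ ⊗ y) (trans x≤x′ (residuation₁ x′ y (x′ ⊗ y) ≤-refl))

  ⊗-mono : ∀ {x x′ y y′} → x ≤ x′ → y ≤ y′ → x ⊗ y ≤ x′ ⊗ y′
  ⊗-mono {x} {x′} {y} {y′} x≤x′ y≤y′ = begin
    x ⊗ y    ≤⟨ ⊗-monoˡ y x≤x′ ⟩
    x′ ⊗ y   ≈⟨ ⊗-comm x′ y ⟩
    y ⊗ x′   ≤⟨ ⊗-monoˡ x′ y≤y′ ⟩
    y′ ⊗ x′  ≈⟨ ⊗-comm y′ x′ ⟩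
    x′ ⊗ y′  ∎

  ⋁-mono : {X : Set a} {f g : X → Carrier} → (∀ i → f i ≤ g i) → ⋁ f ≤ ⋁ g
  ⋁-mono {g = g} f≤g = ⋁-lub _ (⋁ g) (λ i → trans (f≤g i) (⋁-ub g i))

  -- ⊗ distributes over arbitrary joins (the non-trivial inequality; the
  -- other one is monotonicity).  Residuation turns it into a ⋁-lub.
  ⊗-distribʳ-⋁ : {X : Set a} (f : X → Carrier) (y : Carrier)
               → ⋁ f ⊗ y ≤ ⋁ (λ i → f i ⊗ y)
  ⊗-distribʳ-⋁ f y = residuation₂ (⋁ f) y _
    (⋁-lub f _ (λ i → residuation₁ (f i) y _ (⋁-ub (λ j → f j ⊗ y) i)))

  ⊗-distribˡ-⋁ : {X : Set a} (x : Carrier) (f : X → Carrier)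
               → x ⊗ ⋁ f ≤ ⋁ (λ i → x ⊗ f i)
  ⊗-distribˡ-⋁ x f = begin
    x ⊗ ⋁ f               ≈⟨ ⊗-comm x (⋁ f) ⟩
    ⋁ f ⊗ x               ≤⟨ ⊗-distribʳ-⋁ f x ⟩
    ⋁ (λ i → f i ⊗ x)     ≤⟨ ⋁-mono (λ i → reflexive (⊗-comm (f i) x)) ⟩
    ⋁ (λ i → x ⊗ f i)     ∎

module RelationCalculus {a c ℓ₁ ℓ₂} (𝓛 : CompleteResiduatedLattice a c ℓ₁ ℓ₂) where
  open CompleteResiduatedLattice 𝓛
  open FuzzyRelations 𝓛
  open ResiduatedLatticeFacts 𝓛
  open PosetReasoning poset

  infix 4 _≃_
  _≃_ : {A B : Set a} → FRel A B → FRel A B → Set (a ⊔ ℓ₁)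
  R ≃ S = ∀ x y → R x y ≈ S x y

  ⊑-antisym : {A B : Set a} {R S : FRel A B} → R ⊑ S → S ⊑ R → R ≃ S
  ⊑-antisym R⊑S S⊑R x y = antisym (R⊑S x y) (S⊑R x y)

  ≃-sym : {A B : Set a} {R S : FRel A B} → R ≃ S → S ≃ R
  ≃-sym R≃S x y = ≈.sym (R≃S x y)

  ≃⇒⊑ : {A B : Set a} {R S : FRel A B} → R ≃ S → R ⊑ S
  ≃⇒⊑ R≃S x y = reflexive (R≃S x y)

  ⊑-isPreorder : {A B : Set a} → IsPreorder (_≃_ {A} {B}) _⊑_
  ⊑-isPreorder = record
    { isEquivalence = record
        { refl  = λ _ _ → ≈.refl
        ; sym   = ≃-sym
        ; trans = λ R≃S S≃T x y → ≈.trans (R≃S x y) (S≃T x y)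
        }
    ; reflexive = ≃⇒⊑
    ; trans     = λ R⊑S S⊑T x y → trans (R⊑S x y) (S⊑T x y)
    }

  module ⊑-Reasoning {A B : Set a} where
    private module Base = PreorderReasoning (⊑-isPreorder {A} {B})
    open Base public using (begin_; _∎)
    open ⊑-syntax Base._IsRelatedTo_ Base._IsRelatedTo_ Base.≲-go public
    open ≃-syntax Base._IsRelatedTo_ Base._IsRelatedTo_ Base.≈-go ≃-sym public

  ∘-mono : {A B C : Set a} {R R′ : FRel A B} {S S′ : FRel B C}
         → R ⊑ R′ → S ⊑ S′ → (R ∘ᶠ S) ⊑ (R′ ∘ᶠ S′)
  ∘-mono R⊑R′ S⊑S′ x z = ⋁-mono (λ b → ⊗-mono (R⊑R′ x b) (S⊑S′ b z))

  ∘-monoˡ : {A B C : Set a} {R R′ : FRel A B} (S : FRel B C)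
          → R ⊑ R′ → (R ∘ᶠ S) ⊑ (R′ ∘ᶠ S)
  ∘-monoˡ S R⊑R′ = ∘-mono R⊑R′ (λ _ _ → ≤-refl)

  ∘-monoʳ : {A B C : Set a} (R : FRel A B) {S S′ : FRel B C}
          → S ⊑ S′ → (R ∘ᶠ S) ⊑ (R ∘ᶠ S′)
  ∘-monoʳ R = ∘-mono (λ _ _ → ≤-refl)

  -- Associativity: both sides are the join of R x b ⊗ S b c ⊗ T c w over
  -- all b and c; each inclusion distributes ⊗ over the inner join and
  -- reassociates a single summand.
  ∘-assoc-⊑ : {A B C D : Set a} (R : FRel A B) (S : FRel B C) (T : FRel C D)
            → ((R ∘ᶠ S) ∘ᶠ T) ⊑ (R ∘ᶠ (S ∘ᶠ T))
  ∘-assoc-⊑ R S T x w = ⋁-lub _ _ λ c → begin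
    (R ∘ᶠ S) x c ⊗ T c w                 ≤⟨ ⊗-distribʳ-⋁ _ (T c w) ⟩
    ⋁ (λ b → (R x b ⊗ S b c) ⊗ T c w)    ≤⟨ ⋁-lub _ _ (λ b → reassociate b c) ⟩
    (R ∘ᶠ (S ∘ᶠ T)) x w                  ∎
    where
    reassociate : ∀ b c → (R x b ⊗ S b c) ⊗ T c w ≤ (R ∘ᶠ (S ∘ᶠ T)) x w
    reassociate b c = begin
      (R x b ⊗ S b c) ⊗ T c w   ≈⟨ ⊗-assoc (R x b) (S b c) (T c w) ⟩
      R x b ⊗ (S b c ⊗ T c w)   ≤⟨ ⊗-mono ≤-refl (⋁-ub (λ c′ → S b c′ ⊗ T c′ w) c) ⟩
      R x b ⊗ (S ∘ᶠ T) b w      ≤⟨ ⋁-ub (λ b′ → R x b′ ⊗ (S ∘ᶠ T) b′ w) b ⟩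
      (R ∘ᶠ (S ∘ᶠ T)) x w       ∎

  ∘-assoc-⊒ : {A B C D : Set a} (R : FRel A B) (S : FRel B C) (T : FRel C D)
            → (R ∘ᶠ (S ∘ᶠ T)) ⊑ ((R ∘ᶠ S) ∘ᶠ T)
  ∘-assoc-⊒ R S T x w = ⋁-lub _ _ λ b → begin
    R x b ⊗ (S ∘ᶠ T) b w                 ≤⟨ ⊗-distribˡ-⋁ (R x b) _ ⟩
    ⋁ (λ c → R x b ⊗ (S b c ⊗ T c w))    ≤⟨ ⋁-lub _ _ (λ c → reassociate b c) ⟩
    ((R ∘ᶠ S) ∘ᶠ T) x w                  ∎
    where
    reassociate : ∀ b c → R x b ⊗ (S b c ⊗ T c w) ≤ ((R ∘ᶠ S) ∘ᶠ T) x w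
    reassociate b c = begin
      R x b ⊗ (S b c ⊗ T c w)   ≈⟨ ⊗-assoc (R x b) (S b c) (T c w) ⟨
      (R x b ⊗ S b c) ⊗ T c w   ≤⟨ ⊗-mono (⋁-ub (λ b′ → R x b′ ⊗ S b′ c) b) ≤-refl ⟩
      (R ∘ᶠ S) x c ⊗ T c w      ≤⟨ ⋁-ub (λ c′ → (R ∘ᶠ S) x c′ ⊗ T c′ w) c ⟩
      ((R ∘ᶠ S) ∘ᶠ T) x w       ∎

  ∘-assoc : {A B C D : Set a} (R : FRel A B) (S : FRel B C) (T : FRel C D)
          → ((R ∘ᶠ S) ∘ᶠ T) ≃ (R ∘ᶠ (S ∘ᶠ T))
  ∘-assoc R S T = ⊑-antisym (∘-assoc-⊑ R S T) (∘-assoc-⊒ R S T)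

  -- Inversion reverses composition; this is where commutativity of ⊗ is used.
  ⁻¹-anti-∘ : {A B C : Set a} (R : FRel A B) (S : FRel B C)
            → ((R ∘ᶠ S) ⁻¹) ≃ ((S ⁻¹) ∘ᶠ (R ⁻¹))
  ⁻¹-anti-∘ R S = ⊑-antisym
    (λ z x → ⋁-mono (λ b → reflexive (⊗-comm (R x b) (S b z))))
    (λ z x → ⋁-mono (λ b → reflexive (⊗-comm (S b z) (R x b))))

module Simulation {a c ℓ₁ ℓ₂} (𝓛 : CompleteResiduatedLattice a c ℓ₁ ℓ₂) where
  open FuzzyRelations 𝓛
  open RelationCalculus 𝓛

  ∘-simulation : {A B C : Set a} {U : FRel A A} {M : FRel B B} {N : FRel C C}
                 (P : FRel A B) (Q : FRel B C)
               → (P ∘ᶠ M) ⊑ (U ∘ᶠ P) → (Q ∘ᶠ N) ⊑ (M ∘ᶠ Q)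
               → ((P ∘ᶠ Q) ∘ᶠ N) ⊑ (U ∘ᶠ (P ∘ᶠ Q))
  ∘-simulation {U = U} {M} {N} P Q simP simQ = begin
    (P ∘ᶠ Q) ∘ᶠ N     ≃⟨ ∘-assoc P Q N ⟩
    P ∘ᶠ (Q ∘ᶠ N)     ⊑⟨ ∘-monoʳ P simQ ⟩
    P ∘ᶠ (M ∘ᶠ Q)     ≃⟨ ∘-assoc P M Q ⟨
    (P ∘ᶠ M) ∘ᶠ Q     ⊑⟨ ∘-monoˡ Q simP ⟩
    (U ∘ᶠ P) ∘ᶠ Q     ≃⟨ ∘-assoc U P Q ⟩
    U ∘ᶠ (P ∘ᶠ Q)     ∎
    where open ⊑-Reasoning

  -- The backward condition of WL^{2-3} for a composite: it is a simulation
  -- by S⁻¹ ∘ R⁻¹, which equals (R ∘ S)⁻¹.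
  ⁻¹-∘-simulation : {A B C : Set a} {U : FRel A A} {M : FRel B B} {N : FRel C C}
                    (R : FRel A B) (S : FRel B C)
                  → ((R ⁻¹) ∘ᶠ U) ⊑ (M ∘ᶠ (R ⁻¹)) → ((S ⁻¹) ∘ᶠ M) ⊑ (N ∘ᶠ (S ⁻¹))
                  → (((R ∘ᶠ S) ⁻¹) ∘ᶠ U) ⊑ (N ∘ᶠ ((R ∘ᶠ S) ⁻¹))
  ⁻¹-∘-simulation {U = U} {N = N} R S simR simS = begin
    ((R ∘ᶠ S) ⁻¹) ∘ᶠ U          ⊑⟨ ∘-monoˡ U (≃⇒⊑ (⁻¹-anti-∘ R S)) ⟩
    ((S ⁻¹) ∘ᶠ (R ⁻¹)) ∘ᶠ U     ⊑⟨ ∘-simulation (S ⁻¹) (R ⁻¹) simS simR ⟩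
    N ∘ᶠ ((S ⁻¹) ∘ᶠ (R ⁻¹))     ⊑⟨ ∘-monoʳ N (≃⇒⊑ (≃-sym (⁻¹-anti-∘ R S))) ⟩
    N ∘ᶠ ((R ∘ᶠ S) ⁻¹)          ∎
    where open ⊑-Reasoning

proposition4p3 : {a c ℓ₁ ℓ₂ : Level} (𝓛 : CompleteResiduatedLattice a c ℓ₁ ℓ₂)
    → let open FuzzyRelations 𝓛 in
    (A B C I : Set a) → A → B → C → I
    → (V : I → FRel A A) (W : I → FRel B B) (X : I → FRel C C)
    → (Z : FRel A B) (Y : FRel B C) (R : FRel A B) (S : FRel B C)
    → SolutionWL23 A B I V W Z R
    → SolutionWL23 B C I W X Y S
    → SolutionWL23 A C I V X (Z ∘ᶠ Y) (R ∘ᶠ S)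
proposition4p3 𝓛 A B C I _ _ _ _ V W X Z Y R S
  (backwardR , forwardR , R⊑Z) (backwardS , forwardS , S⊑Y) =
    (λ i → ⁻¹-∘-simulation R S (backwardR i) (backwardS i))
  , (λ i → ∘-simulation R S (forwardR i) (forwardS i))
  , ∘-mono R⊑Z S⊑Y
  where
  open Simulation 𝓛
  open RelationCalculus 𝓛 using (∘-mono)
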